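{- In $\mathbf{F}_2^\mu$, the reduction relations $\leadsto_{\beta\mu\tau o} = \leadsto_\beta\cup\leadsto_\mu\cup\leadsto_\tau\cup\leadsto_o$ and $\leadsto_{h\tau o} = \leadsto_h\cup\leadsto_\tau\cup\leadsto_o$ on evidence are confluent, and $\leadsto_\tau$ is strongly normalizing.
   Context: Evidence of $\mathbf{F}_2^\mu$: $e ::= \alpha \mid \kappa \mid \lambda\alpha.e \mid e\,e' \mid \mu\alpha.e \mid e\,T \mid \lambda x.e$, where $\alpha$ are evidence variables, $\kappa$ evidence constants, $x$ type variables and $T$ types ($T ::= F \mid x \mid \lambda x.T \mid \forall x{:}K.T \mid T\,T' \mid T \Rightarrow T'$). On types, $\to_o$ is the compatible closure of $(\lambda x.T)\,T' \to_o [T'/x]T$. Head reduction contexts: $\mathcal{H} ::= \bullet \mid \mathcal{H}\,e \mid \lambda\alpha.\mathcal{H} \mid \lambda x.\mathcal{H}$. General reduction contexts: $\mathcal{C} ::= \bullet \mid \mathcal{C}\,e \mid \mathcal{C}\,T \mid \lambda\alpha.\mathcal{C} \mid \lambda x.\mathcal{C} \mid e\,\mathcal{C} \mid \mu\alpha.\mathcal{C}$. Reductions: $\mathcal{H}[\mu\alpha.e] \leadsto_h \mathcal{H}[[\mu\alpha.e/\alpha]e]$; $\mathcal{H}[(\lambda\alpha.e)\,e'] \leadsto_h \mathcal{H}[[e'/\alpha]e]$; $\mathcal{C}[(\lambda x.e)\,T] \leadsto_\tau \mathcal{C}[[T/x]e]$; $\mathcal{C}[\mu\alpha.e]\leadsto_\mu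 \mathcal{C}[[\mu\alpha.e/\alpha]e]$; $\mathcal{C}[(\lambda\alpha.e)\,e'] \leadsto_\beta \mathcal{C}[[e'/\alpha]e]$; $\mathcal{C}[T] \leadsto_o \mathcal{C}[T']$ whenever $T\to_o T'$. -}

module Defs where

open import Data.Nat using (ℕ; zero; suc)
open import Data.Fin using (Fin; zero; suc)
open import Data.Product using (∃; _×_)
open import Data.Sum using (_⊎_)
open import Relation.Binary.Construct.Closure.ReflexiveTransitive using (Star)

-- Ty n      : types with n free type variables x
-- Ev n m    : evidence with n free type variables and m free evidence
--             variables α
-- Constants F (on types) and κ (on evidence) are indexed by ℕ.

data Kind : Set where
  ⋆    : Kind
  _⟶_ : Kind → Kind → Kind

data Ty (n : ℕ) : Set where
  con  : ℕ → Ty n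
  var  : Fin n → Ty n
  lam  : Ty (suc n) → Ty n
  all  : Kind → Ty (suc n) → Ty n
  _·_  : Ty n → Ty n → Ty n
  _⇒_  : Ty n → Ty n → Ty n

data Ev (n m : ℕ) : Set where
  evar : Fin m → Ev n m
  econ : ℕ → Ev n m
  elam : Ev n (suc m) → Ev n m
  _∙_  : Ev n m → Ev n m → Ev n m
  mu   : Ev n (suc m) → Ev n m
  _⟨_⟩ : Ev n m → Ty n → Ev n m
  tlam : Ev (suc n) m → Ev n m

ext : ∀ {n n'} → (Fin n → Fin n') → Fin (suc n) → Fin (suc n')
ext ρ zero    = zero
ext ρ (suc i) = suc (ρ i)

renT : ∀ {n n'} → (Fin n → Fin n') → Ty n → Ty n'
renT ρ (con F)   = con F
renT ρ (var x)   = var (ρ x)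
renT ρ (lam T)   = lam (renT (ext ρ) T)
renT ρ (all K T) = all K (renT (ext ρ) T)
renT ρ (T · U)   = renT ρ T · renT ρ U
renT ρ (T ⇒ U)   = renT ρ T ⇒ renT ρ U

extsT : ∀ {n n'} → (Fin n → Ty n') → Fin (suc n) → Ty (suc n')
extsT σ zero    = var zero
extsT σ (suc i) = renT suc (σ i)

subT : ∀ {n n'} → (Fin n → Ty n') → Ty n → Ty n'
subT σ (con F)   = con F
subT σ (var x)   = σ x
subT σ (lam T)   = lam (subT (extsT σ) T)
subT σ (all K T) = all K (subT (extsT σ) T)
subT σ (T · U)   = subT σ T · subT σ U
subT σ (T ⇒ U)   = subT σ T ⇒ subT σ U

single : ∀ {n} {A : Set} → (Fin n → A) → A → Fin (suc n) → A
single v a zero    = a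
single v a (suc i) = v i

_[_]T : ∀ {n} → Ty (suc n) → Ty n → Ty n
T [ U ]T = subT (single {A = Ty _} var U) T

renTE : ∀ {n n' m} → (Fin n → Fin n') → Ev n m → Ev n' m
renTE ρ (evar a)  = evar a
renTE ρ (econ k)  = econ k
renTE ρ (elam e)  = elam (renTE ρ e)
renTE ρ (e ∙ e')  = renTE ρ e ∙ renTE ρ e'
renTE ρ (mu e)    = mu (renTE ρ e)
renTE ρ (e ⟨ T ⟩) = renTE ρ e ⟨ renT ρ T ⟩
renTE ρ (tlam e)  = tlam (renTE (ext ρ) e)

subTE : ∀ {n n' m} → (Fin n → Ty n') → Ev n m → Ev n' m
subTE σ (evar a)  = evar a
subTE σ (econ k)  = econ k
subTE σ (elam e)  = elam (subTE σ e)
subTE σ (e ∙ e')  = subTE σ e ∙ subTE σ e'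
subTE σ (mu e)    = mu (subTE σ e)
subTE σ (e ⟨ T ⟩) = subTE σ e ⟨ subT σ T ⟩
subTE σ (tlam e)  = tlam (subTE (extsT σ) e)

_[_]τ : ∀ {n m} → Ev (suc n) m → Ty n → Ev n m
e [ T ]τ = subTE (single {A = Ty _} var T) e

renE : ∀ {n m m'} → (Fin m → Fin m') → Ev n m → Ev n m'
renE ρ (evar a)  = evar (ρ a)
renE ρ (econ k)  = econ k
renE ρ (elam e)  = elam (renE (ext ρ) e)
renE ρ (e ∙ e')  = renE ρ e ∙ renE ρ e'
renE ρ (mu e)    = mu (renE (ext ρ) e)
renE ρ (e ⟨ T ⟩) = renE ρ e ⟨ T ⟩
renE ρ (tlam e)  = tlam (renE ρ e)

extsE : ∀ {n m m'} → (Fin m → Ev n m') → Fin (suc m) → Ev n (suc m')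
extsE σ zero    = evar zero
extsE σ (suc i) = renE suc (σ i)

subE : ∀ {n m m'} → (Fin m → Ev n m') → Ev n m → Ev n m'
subE σ (evar a)  = σ a
subE σ (econ k)  = econ k
subE σ (elam e)  = elam (subE (extsE σ) e)
subE σ (e ∙ e')  = subE σ e ∙ subE σ e'
subE σ (mu e)    = mu (subE (extsE σ) e)
subE σ (e ⟨ T ⟩) = subE σ e ⟨ T ⟩
subE σ (tlam e)  = tlam (subE (λ i → renTE suc (σ i)) e)

_[_]ε : ∀ {n m} → Ev n (suc m) → Ev n m → Ev n m
e [ e' ]ε = subE (single {A = Ev _ _} evar e') e

data _→o_ {n : ℕ} : Ty n → Ty n → Set where
  β    : ∀ {T U} → (lam T · U) →o (T [ U ]T)
  lam  : ∀ {T T'} → T →o T' → lam T →o lam T'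
  all  : ∀ {K T T'} → T →o T' → all K T →o all K T'
  ·ˡ   : ∀ {T T' U} → T →o T' → (T · U) →o (T' · U)
  ·ʳ   : ∀ {T U U'} → U →o U' → (T · U) →o (T · U')
  ⇒ˡ   : ∀ {T T' U} → T →o T' → (T ⇒ U) →o (T' ⇒ U)
  ⇒ʳ   : ∀ {T U U'} → U →o U' → (T ⇒ U) →o (T ⇒ U')

-- Contexts on evidence, presented as closures of a base step relation.

ERel : Set₁
ERel = ∀ {n m} → Ev n m → Ev n m → Set

data Ctx (R : ERel) {n m : ℕ} : Ev n m → Ev n m → Set where
  hole : ∀ {e e'} → R e e' → Ctx R e e'
  appˡ : ∀ {e e' f} → Ctx R e e' → Ctx R (e ∙ f) (e' ∙ f)
  tapp : ∀ {e e' T} → Ctx R e e' → Ctx R (e ⟨ T ⟩) (e' ⟨ T ⟩)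
  elam : ∀ {e e'} → Ctx R {n} {suc m} e e' → Ctx R (elam e) (elam e')
  tlam : ∀ {e e'} → Ctx R {suc n} {m} e e' → Ctx R (tlam e) (tlam e')
  appʳ : ∀ {f e e'} → Ctx R e e' → Ctx R (f ∙ e) (f ∙ e')
  mu   : ∀ {e e'} → Ctx R {n} {suc m} e e' → Ctx R (mu e) (mu e')

data HCtx (R : ERel) {n m : ℕ} : Ev n m → Ev n m → Set where
  hole : ∀ {e e'} → R e e' → HCtx R e e'
  appˡ : ∀ {e e' f} → HCtx R e e' → HCtx R (e ∙ f) (e' ∙ f)
  elam : ∀ {e e'} → HCtx R {n} {suc m} e e' → HCtx R (elam e) (elam e')
  tlam : ∀ {e e'} → HCtx R {suc n} {m} e e' → HCtx R (tlam e) (tlam e')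

data MuStep {n m : ℕ} : Ev n m → Ev n m → Set where
  unfold : ∀ {e} → MuStep (mu e) (e [ mu e ]ε)

data BetaStep {n m : ℕ} : Ev n m → Ev n m → Set where
  beta : ∀ {e e'} → BetaStep (elam e ∙ e') (e [ e' ]ε)

data TauStep {n m : ℕ} : Ev n m → Ev n m → Set where
  tau : ∀ {e T} → TauStep (tlam e ⟨ T ⟩) (e [ T ]τ)

-- a type argument reduces by →o  (the type T in C[T])
data OStep {n m : ℕ} : Ev n m → Ev n m → Set where
  ostep : ∀ {e T T'} → T →o T' → OStep (e ⟨ T ⟩) (e ⟨ T' ⟩)

_⊎ʳ_ : ERel → ERel → ERel
(R ⊎ʳ S) e e' = R e e' ⊎ S e e'

_↝h_ : ERel
_↝h_ = HCtx (MuStep ⊎ʳ BetaStep)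

_↝τ_ : ERel
_↝τ_ = Ctx TauStep

_↝μ_ : ERel
_↝μ_ = Ctx MuStep

_↝β_ : ERel
_↝β_ = Ctx BetaStep

_↝o_ : ERel
_↝o_ = Ctx OStep

_↝βμτo_ : ERel
_↝βμτo_ = _↝β_ ⊎ʳ (_↝μ_ ⊎ʳ (_↝τ_ ⊎ʳ _↝o_))

_↝hτo_ : ERel
_↝hτo_ = _↝h_ ⊎ʳ (_↝τ_ ⊎ʳ _↝o_)

Confluent : {A : Set} → (A → A → Set) → Set
Confluent {A} R = ∀ {a b c : A} → Star R a b → Star R a c →
                  ∃ λ d → Star R b d × Star R c d

data SN {A : Set} (R : A → A → Set) (a : A) : Set where
  sn : (∀ {b} → R a b → SN R b) → SN R a

StronglyNormalizing : {A : Set} → (A → A → Set) → Set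
StronglyNormalizing {A} R = ∀ (a : A) → SN R a

module Submission where

-- Confluence is proved by the Tait–Martin-Löf method.  For each relation R
-- we define a parallel reduction P with R ⊆ P ⊆ R* that has the diamond
-- property; the diamond property makes P confluent, and confluence transfers
-- from P to R because both have the same reflexive–transitive closure.
--   * Types: parallel →o-reduction _⇛_ (the usual parallel β for λx.T).
--   * Evidence: Par βμτo contracts β-, μ-, τ- and o-redexes in parallel;
--     Par τo only τ- and o-redexes.
--   * Head evidence: Hp contracts h-redexes along the spine of head contexts,
--     and τ/o-redexes anywhere (via Par τo).
-- Each diamond property rests on a substitution lemma: parallel reduction
-- is preserved by (type and evidence) substitution of parallel-reduced
-- arguments.
-- Strong normalisation of ↝τ: every τ-step removes one type application
-- e⟨T⟩, and type substitution does not change their number.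

open import Defs
open import Data.Nat using (ℕ; suc; _+_; _<_; s≤s)
open import Data.Nat.Properties using (+-monoˡ-<; +-monoʳ-<; ≤-reflexive)
open import Data.Nat.Induction using (<-wellFounded)
open import Induction.WellFounded using (Acc; acc)
open import Data.Fin using (Fin; zero; suc)
open import Data.Product using (_×_; _,_; ∃)
open import Data.Sum using (_⊎_; inj₁; inj₂)
import Data.Sum as Sum
open import Function using (_∘_; id)
open import Relation.Binary.PropositionalEquality
open import Relation.Binary.Construct.Closure.ReflexiveTransitive
  using (Star; ε; _◅_; _◅◅_; gmap; kleisliStar) renaming (map to Star-map)

variable
  n n' n'' m m' m'' : ℕ

Diamond : {A : Set} → (A → A → Set) → Set
Diamond {A} P = ∀ {a b c : A} → P a b → P a c → ∃ λ d → P b d × P c d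

module _ {A : Set} {P : A → A → Set} (diamond : Diamond P) where

  strip : ∀ {a b c} → P a b → Star P a c → ∃ λ d → Star P b d × P c d
  strip ab ε = _ , ε , ab
  strip ab (ac ◅ cs) with diamond ab ac
  ... | d , bd , cd with strip cd cs
  ...   | e , de , ce = e , bd ◅ de , ce

  diamond⇒confluent : Confluent P
  diamond⇒confluent ε ac = _ , ac , ε
  diamond⇒confluent (ab ◅ bs) ac with strip ab ac
  ... | d , bd , cd with diamond⇒confluent bs bd
  ...   | e , be , de = e , be , cd ◅ de

confluent-between : {A : Set} {R P : A → A → Set} →
                    (∀ {a b} → R a b → P a b) →
                    (∀ {a b} → P a b → Star R a b) →
                    Confluent P → Confluent R
confluent-between R⊆P P⊆R* conf ab ac with conf (Star-map R⊆P ab) (Star-map R⊆P ac)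
... | d , bd , cd = d , kleisliStar id P⊆R* bd , kleisliStar id P⊆R* cd

sn-by-measure : {A : Set} {R : A → A → Set} (μ : A → ℕ) →
                (∀ {a b} → R a b → μ b < μ a) → StronglyNormalizing R
sn-by-measure {R = R} μ decreasing a = sn-acc (<-wellFounded (μ a))
  where
  sn-acc : ∀ {a} → Acc _<_ (μ a) → SN R a
  sn-acc (acc smaller) = sn λ r → sn-acc (smaller (decreasing r))

-- The de Bruijn algebra of renaming and substitution on types.
-- Naming: f-g states how f (g x) fuses into a single traversal; -cong says
-- a traversal depends only on the pointwise values of its argument.

ext-cong : {ρ ρ' : Fin n → Fin n'} → ρ ≗ ρ' → ext ρ ≗ ext ρ'
ext-cong h zero    = refl
ext-cong h (suc i) = cong suc (h i)

renT-cong : {ρ ρ' : Fin n → Fin n'} → ρ ≗ ρ' → ∀ T → renT ρ T ≡ renT ρ' T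
renT-cong h (con F)   = refl
renT-cong h (var x)   = cong var (h x)
renT-cong h (lam T)   = cong lam (renT-cong (ext-cong h) T)
renT-cong h (all K T) = cong (all K) (renT-cong (ext-cong h) T)
renT-cong h (T · U)   = cong₂ _·_ (renT-cong h T) (renT-cong h U)
renT-cong h (T ⇒ U)   = cong₂ _⇒_ (renT-cong h T) (renT-cong h U)

extsT-cong : {σ σ' : Fin n → Ty n'} → σ ≗ σ' → extsT σ ≗ extsT σ'
extsT-cong h zero    = refl
extsT-cong h (suc i) = cong (renT suc) (h i)

subT-cong : {σ σ' : Fin n → Ty n'} → σ ≗ σ' → ∀ T → subT σ T ≡ subT σ' T
subT-cong h (con F)   = refl
subT-cong h (var x)   = h x
subT-cong h (lam T)   = cong lam (subT-cong (extsT-cong h) T)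
subT-cong h (all K T) = cong (all K) (subT-cong (extsT-cong h) T)
subT-cong h (T · U)   = cong₂ _·_ (subT-cong h T) (subT-cong h U)
subT-cong h (T ⇒ U)   = cong₂ _⇒_ (subT-cong h T) (subT-cong h U)

ext-ext : (ρ : Fin n' → Fin n'') (ρ' : Fin n → Fin n') → ext ρ ∘ ext ρ' ≗ ext (ρ ∘ ρ')
ext-ext ρ ρ' zero    = refl
ext-ext ρ ρ' (suc i) = refl

renT-renT : (ρ : Fin n' → Fin n'') (ρ' : Fin n → Fin n') →
            ∀ T → renT ρ (renT ρ' T) ≡ renT (ρ ∘ ρ') T
renT-renT ρ ρ' (con F)   = refl
renT-renT ρ ρ' (var x)   = refl
renT-renT ρ ρ' (lam T)   =
  cong lam (trans (renT-renT (ext ρ) (ext ρ') T) (renT-cong (ext-ext ρ ρ') T))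
renT-renT ρ ρ' (all K T) =
  cong (all K) (trans (renT-renT (ext ρ) (ext ρ') T) (renT-cong (ext-ext ρ ρ') T))
renT-renT ρ ρ' (T · U)   = cong₂ _·_ (renT-renT ρ ρ' T) (renT-renT ρ ρ' U)
renT-renT ρ ρ' (T ⇒ U)   = cong₂ _⇒_ (renT-renT ρ ρ' T) (renT-renT ρ ρ' U)

extsT-ext : (σ : Fin n' → Ty n'') (ρ : Fin n → Fin n') → extsT σ ∘ ext ρ ≗ extsT (σ ∘ ρ)
extsT-ext σ ρ zero    = refl
extsT-ext σ ρ (suc i) = refl

subT-renT : (σ : Fin n' → Ty n'') (ρ : Fin n → Fin n') →
            ∀ T → subT σ (renT ρ T) ≡ subT (σ ∘ ρ) T
subT-renT σ ρ (con F)   = refl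
subT-renT σ ρ (var x)   = refl
subT-renT σ ρ (lam T)   =
  cong lam (trans (subT-renT (extsT σ) (ext ρ) T) (subT-cong (extsT-ext σ ρ) T))
subT-renT σ ρ (all K T) =
  cong (all K) (trans (subT-renT (extsT σ) (ext ρ) T) (subT-cong (extsT-ext σ ρ) T))
subT-renT σ ρ (T · U)   = cong₂ _·_ (subT-renT σ ρ T) (subT-renT σ ρ U)
subT-renT σ ρ (T ⇒ U)   = cong₂ _⇒_ (subT-renT σ ρ T) (subT-renT σ ρ U)

ext-extsT : (ρ : Fin n' → Fin n'') (σ : Fin n → Ty n') →
            renT (ext ρ) ∘ extsT σ ≗ extsT (renT ρ ∘ σ)
ext-extsT ρ σ zero    = refl
ext-extsT ρ σ (suc i) = trans (renT-renT (ext ρ) suc (σ i)) (sym (renT-renT suc ρ (σ i)))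

renT-subT : (ρ : Fin n' → Fin n'') (σ : Fin n → Ty n') →
            ∀ T → renT ρ (subT σ T) ≡ subT (renT ρ ∘ σ) T
renT-subT ρ σ (con F)   = refl
renT-subT ρ σ (var x)   = refl
renT-subT ρ σ (lam T)   =
  cong lam (trans (renT-subT (ext ρ) (extsT σ) T) (subT-cong (ext-extsT ρ σ) T))
renT-subT ρ σ (all K T) =
  cong (all K) (trans (renT-subT (ext ρ) (extsT σ) T) (subT-cong (ext-extsT ρ σ) T))
renT-subT ρ σ (T · U)   = cong₂ _·_ (renT-subT ρ σ T) (renT-subT ρ σ U)
renT-subT ρ σ (T ⇒ U)   = cong₂ _⇒_ (renT-subT ρ σ T) (renT-subT ρ σ U)

extsT-extsT : (σ : Fin n' → Ty n'') (σ' : Fin n → Ty n') →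
              subT (extsT σ) ∘ extsT σ' ≗ extsT (subT σ ∘ σ')
extsT-extsT σ σ' zero    = refl
extsT-extsT σ σ' (suc i) = trans (subT-renT (extsT σ) suc (σ' i)) (sym (renT-subT suc σ (σ' i)))

subT-subT : (σ : Fin n' → Ty n'') (σ' : Fin n → Ty n') →
            ∀ T → subT σ (subT σ' T) ≡ subT (subT σ ∘ σ') T
subT-subT σ σ' (con F)   = refl
subT-subT σ σ' (var x)   = refl
subT-subT σ σ' (lam T)   =
  cong lam (trans (subT-subT (extsT σ) (extsT σ') T) (subT-cong (extsT-extsT σ σ') T))
subT-subT σ σ' (all K T) =
  cong (all K) (trans (subT-subT (extsT σ) (extsT σ') T) (subT-cong (extsT-extsT σ σ') T))
subT-subT σ σ' (T · U)   = cong₂ _·_ (subT-subT σ σ' T) (subT-subT σ σ' U)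
subT-subT σ σ' (T ⇒ U)   = cong₂ _⇒_ (subT-subT σ σ' T) (subT-subT σ σ' U)

extsT-var : extsT (var {n}) ≗ var
extsT-var zero    = refl
extsT-var (suc i) = refl

subT-id : (T : Ty n) → subT var T ≡ T
subT-id (con F)   = refl
subT-id (var x)   = refl
subT-id (lam T)   = cong lam (trans (subT-cong extsT-var T) (subT-id T))
subT-id (all K T) = cong (all K) (trans (subT-cong extsT-var T) (subT-id T))
subT-id (T · U)   = cong₂ _·_ (subT-id T) (subT-id U)
subT-id (T ⇒ U)   = cong₂ _⇒_ (subT-id T) (subT-id U)

extsT-ren : (ρ : Fin n → Fin n') → extsT (var ∘ ρ) ≗ var ∘ ext ρ
extsT-ren ρ zero    = refl
extsT-ren ρ (suc i) = refl

renT-as-subT : (ρ : Fin n → Fin n') → ∀ T → renT ρ T ≡ subT (var ∘ ρ) T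
renT-as-subT ρ (con F)   = refl
renT-as-subT ρ (var x)   = refl
renT-as-subT ρ (lam T)   =
  cong lam (trans (renT-as-subT (ext ρ) T) (sym (subT-cong (extsT-ren ρ) T)))
renT-as-subT ρ (all K T) =
  cong (all K) (trans (renT-as-subT (ext ρ) T) (sym (subT-cong (extsT-ren ρ) T)))
renT-as-subT ρ (T · U)   = cong₂ _·_ (renT-as-subT ρ T) (renT-as-subT ρ U)
renT-as-subT ρ (T ⇒ U)   = cong₂ _⇒_ (renT-as-subT ρ T) (renT-as-subT ρ U)

extsT-single : (σ : Fin n → Ty n') (U : Ty n) →
               subT (single var (subT σ U)) ∘ extsT σ ≗ subT σ ∘ single var U
extsT-single σ U zero    = refl
extsT-single σ U (suc i) = trans (subT-renT _ suc (σ i)) (subT-id (σ i))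

subT-[]T : (σ : Fin n → Ty n') (T : Ty (suc n)) (U : Ty n) →
           subT σ (T [ U ]T) ≡ subT (extsT σ) T [ subT σ U ]T
subT-[]T σ T U = begin
  subT σ (T [ U ]T)                              ≡⟨ subT-subT σ _ T ⟩
  subT (subT σ ∘ single var U) T                 ≡⟨ sym (subT-cong (extsT-single σ U) T) ⟩
  subT (subT (single var (subT σ U)) ∘ extsT σ) T ≡⟨ sym (subT-subT _ (extsT σ) T) ⟩
  subT (extsT σ) T [ subT σ U ]T                 ∎
  where open ≡-Reasoning

renT-[]T : (ρ : Fin n → Fin n') (T : Ty (suc n)) (U : Ty n) →
           renT ρ (T [ U ]T) ≡ renT (ext ρ) T [ renT ρ U ]T
renT-[]T ρ T U = begin
  renT ρ (T [ U ]T)                    ≡⟨ renT-subT ρ _ T ⟩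
  subT (renT ρ ∘ single var U) T       ≡⟨ subT-cong pointwise T ⟩
  subT (single var (renT ρ U) ∘ ext ρ) T ≡⟨ sym (subT-renT _ (ext ρ) T) ⟩
  renT (ext ρ) T [ renT ρ U ]T         ∎
  where
  open ≡-Reasoning
  pointwise : renT ρ ∘ single var U ≗ single var (renT ρ U) ∘ ext ρ
  pointwise zero    = refl
  pointwise (suc i) = refl

infix 4 _⇛_
data _⇛_ {n : ℕ} : Ty n → Ty n → Set where
  tcon  : ∀ {F} → con F ⇛ con F
  tvar  : ∀ {x} → var x ⇛ var x
  tlam  : ∀ {T T'} → T ⇛ T' → lam T ⇛ lam T'
  tall  : ∀ {K T T'} → T ⇛ T' → all K T ⇛ all K T'
  tapp  : ∀ {T T' U U'} → T ⇛ T' → U ⇛ U' → T · U ⇛ T' · U'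
  tarr  : ∀ {T T' U U'} → T ⇛ T' → U ⇛ U' → T ⇒ U ⇛ T' ⇒ U'
  tbeta : ∀ {T T' U U'} → T ⇛ T' → U ⇛ U' → lam T · U ⇛ T' [ U' ]T

⇛-refl : (T : Ty n) → T ⇛ T
⇛-refl (con F)   = tcon
⇛-refl (var x)   = tvar
⇛-refl (lam T)   = tlam (⇛-refl T)
⇛-refl (all K T) = tall (⇛-refl T)
⇛-refl (T · U)   = tapp (⇛-refl T) (⇛-refl U)
⇛-refl (T ⇒ U)   = tarr (⇛-refl T) (⇛-refl U)

⇛-renT : (ρ : Fin n → Fin n') {T T' : Ty n} → T ⇛ T' → renT ρ T ⇛ renT ρ T'
⇛-renT ρ tcon       = tcon
⇛-renT ρ tvar       = tvar
⇛-renT ρ (tlam p)   = tlam (⇛-renT (ext ρ) p)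
⇛-renT ρ (tall p)   = tall (⇛-renT (ext ρ) p)
⇛-renT ρ (tapp p q) = tapp (⇛-renT ρ p) (⇛-renT ρ q)
⇛-renT ρ (tarr p q) = tarr (⇛-renT ρ p) (⇛-renT ρ q)
⇛-renT ρ (tbeta {T' = T'} {U' = U'} p q) =
  subst (_ ⇛_) (sym (renT-[]T ρ T' U')) (tbeta (⇛-renT (ext ρ) p) (⇛-renT ρ q))

_⇛ˢ_ : (σ σ' : Fin n → Ty n') → Set
σ ⇛ˢ σ' = ∀ i → σ i ⇛ σ' i

⇛ˢ-extsT : {σ σ' : Fin n → Ty n'} → σ ⇛ˢ σ' → extsT σ ⇛ˢ extsT σ'
⇛ˢ-extsT h zero    = tvar
⇛ˢ-extsT h (suc i) = ⇛-renT suc (h i)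

⇛ˢ-single : {U U' : Ty n} → U ⇛ U' → single var U ⇛ˢ single var U'
⇛ˢ-single q zero    = q
⇛ˢ-single q (suc i) = tvar

⇛-subT : {σ σ' : Fin n → Ty n'} → σ ⇛ˢ σ' → {T T' : Ty n} → T ⇛ T' → subT σ T ⇛ subT σ' T'
⇛-subT h tcon       = tcon
⇛-subT h (tvar {x}) = h x
⇛-subT h (tlam p)   = tlam (⇛-subT (⇛ˢ-extsT h) p)
⇛-subT h (tall p)   = tall (⇛-subT (⇛ˢ-extsT h) p)
⇛-subT h (tapp p q) = tapp (⇛-subT h p) (⇛-subT h q)
⇛-subT h (tarr p q) = tarr (⇛-subT h p) (⇛-subT h q)
⇛-subT {σ' = σ'} h (tbeta {T' = T'} {U' = U'} p q) =
  subst (_ ⇛_) (sym (subT-[]T σ' T' U')) (tbeta (⇛-subT (⇛ˢ-extsT h) p) (⇛-subT h q))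

⇛-[]T : {T T' : Ty (suc n)} {U U' : Ty n} → T ⇛ T' → U ⇛ U' → T [ U ]T ⇛ T' [ U' ]T
⇛-[]T p q = ⇛-subT (⇛ˢ-single q) p

-- When only one side contracts a redex, the other side catches up by
-- contracting its residual; ⇛-[]T closes the resulting square.
⇛-diamond : Diamond (_⇛_ {n})
⇛-diamond tcon tcon = _ , tcon , tcon
⇛-diamond tvar tvar = _ , tvar , tvar
⇛-diamond (tlam p) (tlam q) with ⇛-diamond p q
... | _ , p' , q' = _ , tlam p' , tlam q'
⇛-diamond (tall p) (tall q) with ⇛-diamond p q
... | _ , p' , q' = _ , tall p' , tall q'
⇛-diamond (tapp p₁ p₂) (tapp q₁ q₂) with ⇛-diamond p₁ q₁ | ⇛-diamond p₂ q₂
... | _ , p₁' , q₁' | _ , p₂' , q₂' = _ , tapp p₁' p₂' , tapp q₁' q₂'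
⇛-diamond (tarr p₁ p₂) (tarr q₁ q₂) with ⇛-diamond p₁ q₁ | ⇛-diamond p₂ q₂
... | _ , p₁' , q₁' | _ , p₂' , q₂' = _ , tarr p₁' p₂' , tarr q₁' q₂'
⇛-diamond (tapp (tlam p₁) p₂) (tbeta q₁ q₂) with ⇛-diamond p₁ q₁ | ⇛-diamond p₂ q₂
... | _ , p₁' , q₁' | _ , p₂' , q₂' = _ , tbeta p₁' p₂' , ⇛-[]T q₁' q₂'
⇛-diamond (tbeta p₁ p₂) (tapp (tlam q₁) q₂) with ⇛-diamond p₁ q₁ | ⇛-diamond p₂ q₂
... | _ , p₁' , q₁' | _ , p₂' , q₂' = _ , ⇛-[]T p₁' p₂' , tbeta q₁' q₂'
⇛-diamond (tbeta p₁ p₂) (tbeta q₁ q₂) with ⇛-diamond p₁ q₁ | ⇛-diamond p₂ q₂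
... | _ , p₁' , q₁' | _ , p₂' , q₂' = _ , ⇛-[]T p₁' p₂' , ⇛-[]T q₁' q₂'

→o⇒⇛ : {T T' : Ty n} → T →o T' → T ⇛ T'
→o⇒⇛ β       = tbeta (⇛-refl _) (⇛-refl _)
→o⇒⇛ (lam s) = tlam (→o⇒⇛ s)
→o⇒⇛ (all s) = tall (→o⇒⇛ s)
→o⇒⇛ (·ˡ s)  = tapp (→o⇒⇛ s) (⇛-refl _)
→o⇒⇛ (·ʳ s)  = tapp (⇛-refl _) (→o⇒⇛ s)
→o⇒⇛ (⇒ˡ s)  = tarr (→o⇒⇛ s) (⇛-refl _)
→o⇒⇛ (⇒ʳ s)  = tarr (⇛-refl _) (→o⇒⇛ s)

⇛⇒→o* : {T T' : Ty n} → T ⇛ T' → Star _→o_ T T'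
⇛⇒→o* tcon     = ε
⇛⇒→o* tvar     = ε
⇛⇒→o* (tlam p) = gmap Ty.lam _→o_.lam (⇛⇒→o* p)
⇛⇒→o* (tall {K = K} p) = gmap (all K) _→o_.all (⇛⇒→o* p)
⇛⇒→o* (tapp {T' = T'} {U = U} p q) = gmap (_· U) ·ˡ (⇛⇒→o* p) ◅◅ gmap (T' ·_) ·ʳ (⇛⇒→o* q)
⇛⇒→o* (tarr {T' = T'} {U = U} p q) = gmap (_⇒ U) ⇒ˡ (⇛⇒→o* p) ◅◅ gmap (T' ⇒_) ⇒ʳ (⇛⇒→o* q)
⇛⇒→o* (tbeta {U = U} p q) =
  gmap (_· U) ·ˡ (gmap Ty.lam _→o_.lam (⇛⇒→o* p)) ◅◅ gmap (_ ·_) ·ʳ (⇛⇒→o* q) ◅◅ β ◅ ε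

renTE-cong : {ρ ρ' : Fin n → Fin n'} → ρ ≗ ρ' → (e : Ev n m) → renTE ρ e ≡ renTE ρ' e
renTE-cong h (evar a)  = refl
renTE-cong h (econ k)  = refl
renTE-cong h (elam e)  = cong elam (renTE-cong h e)
renTE-cong h (e ∙ f)   = cong₂ _∙_ (renTE-cong h e) (renTE-cong h f)
renTE-cong h (mu e)    = cong mu (renTE-cong h e)
renTE-cong h (e ⟨ T ⟩) = cong₂ _⟨_⟩ (renTE-cong h e) (renT-cong h T)
renTE-cong h (tlam e)  = cong tlam (renTE-cong (ext-cong h) e)

subTE-cong : {σ σ' : Fin n → Ty n'} → σ ≗ σ' → (e : Ev n m) → subTE σ e ≡ subTE σ' e
subTE-cong h (evar a)  = refl
subTE-cong h (econ k)  = refl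
subTE-cong h (elam e)  = cong elam (subTE-cong h e)
subTE-cong h (e ∙ f)   = cong₂ _∙_ (subTE-cong h e) (subTE-cong h f)
subTE-cong h (mu e)    = cong mu (subTE-cong h e)
subTE-cong h (e ⟨ T ⟩) = cong₂ _⟨_⟩ (subTE-cong h e) (subT-cong h T)
subTE-cong h (tlam e)  = cong tlam (subTE-cong (extsT-cong h) e)

renTE-renTE : (ρ : Fin n' → Fin n'') (ρ' : Fin n → Fin n') →
              (e : Ev n m) → renTE ρ (renTE ρ' e) ≡ renTE (ρ ∘ ρ') e
renTE-renTE ρ ρ' (evar x)  = refl
renTE-renTE ρ ρ' (econ k)  = refl
renTE-renTE ρ ρ' (elam e)  = cong elam (renTE-renTE ρ ρ' e)
renTE-renTE ρ ρ' (e ∙ f)   = cong₂ _∙_ (renTE-renTE ρ ρ' e) (renTE-renTE ρ ρ' f)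
renTE-renTE ρ ρ' (mu e)    = cong mu (renTE-renTE ρ ρ' e)
renTE-renTE ρ ρ' (e ⟨ T ⟩) = cong₂ _⟨_⟩ (renTE-renTE ρ ρ' e) (renT-renT ρ ρ' T)
renTE-renTE ρ ρ' (tlam e)  =
  cong tlam (trans (renTE-renTE (ext ρ) (ext ρ') e) (renTE-cong (ext-ext ρ ρ') e))

subTE-renTE : (σ : Fin n' → Ty n'') (ρ : Fin n → Fin n') →
              (e : Ev n m) → subTE σ (renTE ρ e) ≡ subTE (σ ∘ ρ) e
subTE-renTE σ ρ (evar x)  = refl
subTE-renTE σ ρ (econ k)  = refl
subTE-renTE σ ρ (elam e)  = cong elam (subTE-renTE σ ρ e)
subTE-renTE σ ρ (e ∙ f)   = cong₂ _∙_ (subTE-renTE σ ρ e) (subTE-renTE σ ρ f)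
subTE-renTE σ ρ (mu e)    = cong mu (subTE-renTE σ ρ e)
subTE-renTE σ ρ (e ⟨ T ⟩) = cong₂ _⟨_⟩ (subTE-renTE σ ρ e) (subT-renT σ ρ T)
subTE-renTE σ ρ (tlam e)  =
  cong tlam (trans (subTE-renTE (extsT σ) (ext ρ) e) (subTE-cong (extsT-ext σ ρ) e))

renTE-subTE : (ρ : Fin n' → Fin n'') (σ : Fin n → Ty n') →
              (e : Ev n m) → renTE ρ (subTE σ e) ≡ subTE (renT ρ ∘ σ) e
renTE-subTE ρ σ (evar x)  = refl
renTE-subTE ρ σ (econ k)  = refl
renTE-subTE ρ σ (elam e)  = cong elam (renTE-subTE ρ σ e)
renTE-subTE ρ σ (e ∙ f)   = cong₂ _∙_ (renTE-subTE ρ σ e) (renTE-subTE ρ σ f)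
renTE-subTE ρ σ (mu e)    = cong mu (renTE-subTE ρ σ e)
renTE-subTE ρ σ (e ⟨ T ⟩) = cong₂ _⟨_⟩ (renTE-subTE ρ σ e) (renT-subT ρ σ T)
renTE-subTE ρ σ (tlam e)  =
  cong tlam (trans (renTE-subTE (ext ρ) (extsT σ) e) (subTE-cong (ext-extsT ρ σ) e))

subTE-subTE : (σ : Fin n' → Ty n'') (σ' : Fin n → Ty n') →
              (e : Ev n m) → subTE σ (subTE σ' e) ≡ subTE (subT σ ∘ σ') e
subTE-subTE σ σ' (evar x)  = refl
subTE-subTE σ σ' (econ k)  = refl
subTE-subTE σ σ' (elam e)  = cong elam (subTE-subTE σ σ' e)
subTE-subTE σ σ' (e ∙ f)   = cong₂ _∙_ (subTE-subTE σ σ' e) (subTE-subTE σ σ' f)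
subTE-subTE σ σ' (mu e)    = cong mu (subTE-subTE σ σ' e)
subTE-subTE σ σ' (e ⟨ T ⟩) = cong₂ _⟨_⟩ (subTE-subTE σ σ' e) (subT-subT σ σ' T)
subTE-subTE σ σ' (tlam e)  =
  cong tlam (trans (subTE-subTE (extsT σ) (extsT σ') e) (subTE-cong (extsT-extsT σ σ') e))

subTE-id : (e : Ev n m) → subTE var e ≡ e
subTE-id (evar x)  = refl
subTE-id (econ k)  = refl
subTE-id (elam e)  = cong elam (subTE-id e)
subTE-id (e ∙ f)   = cong₂ _∙_ (subTE-id e) (subTE-id f)
subTE-id (mu e)    = cong mu (subTE-id e)
subTE-id (e ⟨ T ⟩) = cong₂ _⟨_⟩ (subTE-id e) (subT-id T)
subTE-id (tlam e)  = cong tlam (trans (subTE-cong extsT-var e) (subTE-id e))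

renTE-as-subTE : (ρ : Fin n → Fin n') (e : Ev n m) → renTE ρ e ≡ subTE (var ∘ ρ) e
renTE-as-subTE ρ (evar x)  = refl
renTE-as-subTE ρ (econ k)  = refl
renTE-as-subTE ρ (elam e)  = cong elam (renTE-as-subTE ρ e)
renTE-as-subTE ρ (e ∙ f)   = cong₂ _∙_ (renTE-as-subTE ρ e) (renTE-as-subTE ρ f)
renTE-as-subTE ρ (mu e)    = cong mu (renTE-as-subTE ρ e)
renTE-as-subTE ρ (e ⟨ T ⟩) = cong₂ _⟨_⟩ (renTE-as-subTE ρ e) (renT-as-subT ρ T)
renTE-as-subTE ρ (tlam e)  =
  cong tlam (trans (renTE-as-subTE (ext ρ) e) (sym (subTE-cong (extsT-ren ρ) e)))

subTE-[]τ : (σ : Fin n → Ty n') (e : Ev (suc n) m) (T : Ty n) →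
            subTE σ (e [ T ]τ) ≡ subTE (extsT σ) e [ subT σ T ]τ
subTE-[]τ σ e T = begin
  subTE σ (e [ T ]τ)                              ≡⟨ subTE-subTE σ _ e ⟩
  subTE (subT σ ∘ single var T) e                 ≡⟨ sym (subTE-cong (extsT-single σ T) e) ⟩
  subTE (subT (single var (subT σ T)) ∘ extsT σ) e ≡⟨ sym (subTE-subTE _ (extsT σ) e) ⟩
  subTE (extsT σ) e [ subT σ T ]τ                 ∎
  where open ≡-Reasoning

weaken-[]τ : (T : Ty n) (e : Ev n m) → renTE suc e [ T ]τ ≡ e
weaken-[]τ T e = trans (subTE-renTE _ suc e) (subTE-id e)

renE-cong : {ρ ρ' : Fin m → Fin m'} → ρ ≗ ρ' → (e : Ev n m) → renE ρ e ≡ renE ρ' e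
renE-cong h (evar a)  = cong evar (h a)
renE-cong h (econ k)  = refl
renE-cong h (elam e)  = cong elam (renE-cong (ext-cong h) e)
renE-cong h (e ∙ f)   = cong₂ _∙_ (renE-cong h e) (renE-cong h f)
renE-cong h (mu e)    = cong mu (renE-cong (ext-cong h) e)
renE-cong h (e ⟨ T ⟩) = cong (_⟨ T ⟩) (renE-cong h e)
renE-cong h (tlam e)  = cong tlam (renE-cong h e)

extsE-cong : {σ σ' : Fin m → Ev n m'} → σ ≗ σ' → extsE σ ≗ extsE σ'
extsE-cong h zero    = refl
extsE-cong h (suc i) = cong (renE suc) (h i)

subE-cong : {σ σ' : Fin m → Ev n m'} → σ ≗ σ' → (e : Ev n m) → subE σ e ≡ subE σ' e
subE-cong h (evar a)  = h a
subE-cong h (econ k)  = refl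
subE-cong h (elam e)  = cong elam (subE-cong (extsE-cong h) e)
subE-cong h (e ∙ f)   = cong₂ _∙_ (subE-cong h e) (subE-cong h f)
subE-cong h (mu e)    = cong mu (subE-cong (extsE-cong h) e)
subE-cong h (e ⟨ T ⟩) = cong (_⟨ T ⟩) (subE-cong h e)
subE-cong h (tlam e)  = cong tlam (subE-cong (cong (renTE suc) ∘ h) e)

renE-renE : (ρ : Fin m' → Fin m'') (ρ' : Fin m → Fin m') →
            (e : Ev n m) → renE ρ (renE ρ' e) ≡ renE (ρ ∘ ρ') e
renE-renE ρ ρ' (evar x)  = refl
renE-renE ρ ρ' (econ k)  = refl
renE-renE ρ ρ' (elam e)  =
  cong elam (trans (renE-renE (ext ρ) (ext ρ') e) (renE-cong (ext-ext ρ ρ') e))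
renE-renE ρ ρ' (e ∙ f)   = cong₂ _∙_ (renE-renE ρ ρ' e) (renE-renE ρ ρ' f)
renE-renE ρ ρ' (mu e)    =
  cong mu (trans (renE-renE (ext ρ) (ext ρ') e) (renE-cong (ext-ext ρ ρ') e))
renE-renE ρ ρ' (e ⟨ T ⟩) = cong (_⟨ T ⟩) (renE-renE ρ ρ' e)
renE-renE ρ ρ' (tlam e)  = cong tlam (renE-renE ρ ρ' e)

extsE-ext : (σ : Fin m' → Ev n m'') (ρ : Fin m → Fin m') → extsE σ ∘ ext ρ ≗ extsE (σ ∘ ρ)
extsE-ext σ ρ zero    = refl
extsE-ext σ ρ (suc i) = refl

subE-renE : (σ : Fin m' → Ev n m'') (ρ : Fin m → Fin m') →
            (e : Ev n m) → subE σ (renE ρ e) ≡ subE (σ ∘ ρ) e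
subE-renE σ ρ (evar x)  = refl
subE-renE σ ρ (econ k)  = refl
subE-renE σ ρ (elam e)  =
  cong elam (trans (subE-renE (extsE σ) (ext ρ) e) (subE-cong (extsE-ext σ ρ) e))
subE-renE σ ρ (e ∙ f)   = cong₂ _∙_ (subE-renE σ ρ e) (subE-renE σ ρ f)
subE-renE σ ρ (mu e)    =
  cong mu (trans (subE-renE (extsE σ) (ext ρ) e) (subE-cong (extsE-ext σ ρ) e))
subE-renE σ ρ (e ⟨ T ⟩) = cong (_⟨ T ⟩) (subE-renE σ ρ e)
subE-renE σ ρ (tlam e)  = cong tlam (subE-renE (renTE suc ∘ σ) ρ e)

renE-renTE : (ρ : Fin m → Fin m') (ρ' : Fin n → Fin n') →
             (e : Ev n m) → renE ρ (renTE ρ' e) ≡ renTE ρ' (renE ρ e)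
renE-renTE ρ ρ' (evar x)  = refl
renE-renTE ρ ρ' (econ k)  = refl
renE-renTE ρ ρ' (elam e)  = cong elam (renE-renTE (ext ρ) ρ' e)
renE-renTE ρ ρ' (e ∙ f)   = cong₂ _∙_ (renE-renTE ρ ρ' e) (renE-renTE ρ ρ' f)
renE-renTE ρ ρ' (mu e)    = cong mu (renE-renTE (ext ρ) ρ' e)
renE-renTE ρ ρ' (e ⟨ T ⟩) = cong (_⟨ _ ⟩) (renE-renTE ρ ρ' e)
renE-renTE ρ ρ' (tlam e)  = cong tlam (renE-renTE ρ (ext ρ') e)

ext-extsE : (ρ : Fin m' → Fin m'') (σ : Fin m → Ev n m') →
            renE (ext ρ) ∘ extsE σ ≗ extsE (renE ρ ∘ σ)
ext-extsE ρ σ zero    = refl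
ext-extsE ρ σ (suc i) = trans (renE-renE (ext ρ) suc (σ i)) (sym (renE-renE suc ρ (σ i)))

renE-subE : (ρ : Fin m' → Fin m'') (σ : Fin m → Ev n m') →
            (e : Ev n m) → renE ρ (subE σ e) ≡ subE (renE ρ ∘ σ) e
renE-subE ρ σ (evar x)  = refl
renE-subE ρ σ (econ k)  = refl
renE-subE ρ σ (elam e)  =
  cong elam (trans (renE-subE (ext ρ) (extsE σ) e) (subE-cong (ext-extsE ρ σ) e))
renE-subE ρ σ (e ∙ f)   = cong₂ _∙_ (renE-subE ρ σ e) (renE-subE ρ σ f)
renE-subE ρ σ (mu e)    =
  cong mu (trans (renE-subE (ext ρ) (extsE σ) e) (subE-cong (ext-extsE ρ σ) e))
renE-subE ρ σ (e ⟨ T ⟩) = cong (_⟨ T ⟩) (renE-subE ρ σ e)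
renE-subE ρ σ (tlam e)  =
  cong tlam (trans (renE-subE ρ (renTE suc ∘ σ) e) (subE-cong (λ i → renE-renTE ρ suc (σ i)) e))

renTE-extsE : (ρ : Fin n → Fin n') (σ : Fin m → Ev n m') →
              renTE ρ ∘ extsE σ ≗ extsE (renTE ρ ∘ σ)
renTE-extsE ρ σ zero    = refl
renTE-extsE ρ σ (suc i) = sym (renE-renTE suc ρ (σ i))

renTE-subE : (ρ : Fin n → Fin n') (σ : Fin m → Ev n m') →
             (e : Ev n m) → renTE ρ (subE σ e) ≡ subE (renTE ρ ∘ σ) (renTE ρ e)
renTE-subE ρ σ (evar x)  = refl
renTE-subE ρ σ (econ k)  = refl
renTE-subE ρ σ (elam e)  =
  cong elam (trans (renTE-subE ρ (extsE σ) e) (subE-cong (renTE-extsE ρ σ) (renTE ρ e)))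
renTE-subE ρ σ (e ∙ f)   = cong₂ _∙_ (renTE-subE ρ σ e) (renTE-subE ρ σ f)
renTE-subE ρ σ (mu e)    =
  cong mu (trans (renTE-subE ρ (extsE σ) e) (subE-cong (renTE-extsE ρ σ) (renTE ρ e)))
renTE-subE ρ σ (e ⟨ T ⟩) = cong (_⟨ _ ⟩) (renTE-subE ρ σ e)
renTE-subE ρ σ (tlam e)  = cong tlam (trans (renTE-subE (ext ρ) (renTE suc ∘ σ) e)
  (subE-cong (λ i → trans (renTE-renTE (ext ρ) suc (σ i)) (sym (renTE-renTE suc ρ (σ i))))
             (renTE (ext ρ) e)))

extsE-extsE : (σ : Fin m' → Ev n m'') (σ' : Fin m → Ev n m') →
              subE (extsE σ) ∘ extsE σ' ≗ extsE (subE σ ∘ σ')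
extsE-extsE σ σ' zero    = refl
extsE-extsE σ σ' (suc i) = trans (subE-renE (extsE σ) suc (σ' i)) (sym (renE-subE suc σ (σ' i)))

subE-subE : (σ : Fin m' → Ev n m'') (σ' : Fin m → Ev n m') →
            (e : Ev n m) → subE σ (subE σ' e) ≡ subE (subE σ ∘ σ') e
subE-subE σ σ' (evar x)  = refl
subE-subE σ σ' (econ k)  = refl
subE-subE σ σ' (elam e)  =
  cong elam (trans (subE-subE (extsE σ) (extsE σ') e) (subE-cong (extsE-extsE σ σ') e))
subE-subE σ σ' (e ∙ f)   = cong₂ _∙_ (subE-subE σ σ' e) (subE-subE σ σ' f)
subE-subE σ σ' (mu e)    =
  cong mu (trans (subE-subE (extsE σ) (extsE σ') e) (subE-cong (extsE-extsE σ σ') e))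
subE-subE σ σ' (e ⟨ T ⟩) = cong (_⟨ T ⟩) (subE-subE σ σ' e)
subE-subE σ σ' (tlam e)  = cong tlam (trans (subE-subE (renTE suc ∘ σ) (renTE suc ∘ σ') e)
  (subE-cong (λ i → sym (renTE-subE suc σ (σ' i))) e))

extsE-evar : extsE (evar {n} {m}) ≗ evar
extsE-evar zero    = refl
extsE-evar (suc i) = refl

subE-id : (e : Ev n m) → subE evar e ≡ e
subE-id (evar x)  = refl
subE-id (econ k)  = refl
subE-id (elam e)  = cong elam (trans (subE-cong extsE-evar e) (subE-id e))
subE-id (e ∙ f)   = cong₂ _∙_ (subE-id e) (subE-id f)
subE-id (mu e)    = cong mu (trans (subE-cong extsE-evar e) (subE-id e))
subE-id (e ⟨ T ⟩) = cong (_⟨ T ⟩) (subE-id e)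
subE-id (tlam e)  = cong tlam (subE-id e)

subTE-renE : (σ : Fin n → Ty n') (ρ : Fin m → Fin m') →
             (e : Ev n m) → subTE σ (renE ρ e) ≡ renE ρ (subTE σ e)
subTE-renE σ ρ (evar x)  = refl
subTE-renE σ ρ (econ k)  = refl
subTE-renE σ ρ (elam e)  = cong elam (subTE-renE σ (ext ρ) e)
subTE-renE σ ρ (e ∙ f)   = cong₂ _∙_ (subTE-renE σ ρ e) (subTE-renE σ ρ f)
subTE-renE σ ρ (mu e)    = cong mu (subTE-renE σ (ext ρ) e)
subTE-renE σ ρ (e ⟨ T ⟩) = cong (_⟨ _ ⟩) (subTE-renE σ ρ e)
subTE-renE σ ρ (tlam e)  = cong tlam (subTE-renE (extsT σ) ρ e)

subTE-extsE : (σ : Fin n → Ty n') (σ' : Fin m → Ev n m') →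
              subTE σ ∘ extsE σ' ≗ extsE (subTE σ ∘ σ')
subTE-extsE σ σ' zero    = refl
subTE-extsE σ σ' (suc i) = subTE-renE σ suc (σ' i)

subTE-subE : (σ : Fin n → Ty n') (σ' : Fin m → Ev n m') →
             (e : Ev n m) → subTE σ (subE σ' e) ≡ subE (subTE σ ∘ σ') (subTE σ e)
subTE-subE σ σ' (evar x)  = refl
subTE-subE σ σ' (econ k)  = refl
subTE-subE σ σ' (elam e)  =
  cong elam (trans (subTE-subE σ (extsE σ') e) (subE-cong (subTE-extsE σ σ') (subTE σ e)))
subTE-subE σ σ' (e ∙ f)   = cong₂ _∙_ (subTE-subE σ σ' e) (subTE-subE σ σ' f)
subTE-subE σ σ' (mu e)    =
  cong mu (trans (subTE-subE σ (extsE σ') e) (subE-cong (subTE-extsE σ σ') (subTE σ e)))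
subTE-subE σ σ' (e ⟨ T ⟩) = cong (_⟨ _ ⟩) (subTE-subE σ σ' e)
subTE-subE σ σ' (tlam e)  = cong tlam (trans (subTE-subE (extsT σ) (renTE suc ∘ σ') e)
  (subE-cong (λ i → trans (subTE-renTE (extsT σ) suc (σ' i)) (sym (renTE-subTE suc σ (σ' i))))
             (subTE (extsT σ) e)))

subE-[]ε : (σ : Fin m → Ev n m') (e : Ev n (suc m)) (f : Ev n m) →
           subE σ (e [ f ]ε) ≡ subE (extsE σ) e [ subE σ f ]ε
subE-[]ε σ e f = begin
  subE σ (e [ f ]ε)                               ≡⟨ subE-subE σ _ e ⟩
  subE (subE σ ∘ single evar f) e                 ≡⟨ sym (subE-cong pointwise e) ⟩
  subE (subE (single evar (subE σ f)) ∘ extsE σ) e ≡⟨ sym (subE-subE _ (extsE σ) e) ⟩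
  subE (extsE σ) e [ subE σ f ]ε                  ∎
  where
  open ≡-Reasoning
  pointwise : subE (single evar (subE σ f)) ∘ extsE σ ≗ subE σ ∘ single evar f
  pointwise zero    = refl
  pointwise (suc i) = trans (subE-renE _ suc (σ i)) (subE-id (σ i))

renE-[]ε : (ρ : Fin m → Fin m') (e : Ev n (suc m)) (f : Ev n m) →
           renE ρ (e [ f ]ε) ≡ renE (ext ρ) e [ renE ρ f ]ε
renE-[]ε ρ e f = begin
  renE ρ (e [ f ]ε)                      ≡⟨ renE-subE ρ _ e ⟩
  subE (renE ρ ∘ single evar f) e        ≡⟨ subE-cong pointwise e ⟩
  subE (single evar (renE ρ f) ∘ ext ρ) e ≡⟨ sym (subE-renE _ (ext ρ) e) ⟩
  renE (ext ρ) e [ renE ρ f ]ε           ∎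
  where
  open ≡-Reasoning
  pointwise : renE ρ ∘ single evar f ≗ single evar (renE ρ f) ∘ ext ρ
  pointwise zero    = refl
  pointwise (suc i) = refl

subTE-[]ε : (σ : Fin n → Ty n') (e : Ev n (suc m)) (f : Ev n m) →
            subTE σ (e [ f ]ε) ≡ subTE σ e [ subTE σ f ]ε
subTE-[]ε σ e f = trans (subTE-subE σ _ e) (subE-cong pointwise (subTE σ e))
  where
  pointwise : subTE σ ∘ single evar f ≗ single evar (subTE σ f)
  pointwise zero    = refl
  pointwise (suc i) = refl

subE-[]τ : (σ : Fin m → Ev n m') (e : Ev (suc n) m) (T : Ty n) →
           subE σ (e [ T ]τ) ≡ subE (renTE suc ∘ σ) e [ T ]τ
subE-[]τ σ e T =
  sym (trans (subTE-subE _ (renTE suc ∘ σ) e) (subE-cong (weaken-[]τ T ∘ σ) (e [ T ]τ)))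

renE-[]τ : (ρ : Fin m → Fin m') (e : Ev (suc n) m) (T : Ty n) →
           renE ρ (e [ T ]τ) ≡ renE ρ e [ T ]τ
renE-[]τ ρ e T = sym (subTE-renE _ ρ e)

-- Parallel reduction on evidence comes in two modes: Par τo contracts τ- and o-redexes anywhere; Par βμτo additionally
-- contracts β- and μ-redexes anywhere.

data Mode : Set where
  τo βμτo : Mode

variable
  b : Mode

data Par : Mode → ∀ {n m} → Ev n m → Ev n m → Set where
  pvar  : {a : Fin m} → Par b {n} (evar a) (evar a)
  pcon  : ∀ {k} → Par b {n} {m} (econ k) (econ k)
  pelam : {e e' : Ev n (suc m)} → Par b e e' → Par b (elam e) (elam e')
  ptlam : {e e' : Ev (suc n) m} → Par b e e' → Par b (tlam e) (tlam e')
  papp  : {e e' f f' : Ev n m} → Par b e e' → Par b f f' → Par b (e ∙ f) (e' ∙ f')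
  pmu   : {e e' : Ev n (suc m)} → Par b e e' → Par b (mu e) (mu e')
  ptapp : {e e' : Ev n m} {T T' : Ty n} → Par b e e' → T ⇛ T' → Par b (e ⟨ T ⟩) (e' ⟨ T' ⟩)
  ptau  : {e e' : Ev (suc n) m} {T T' : Ty n} →
          Par b e e' → T ⇛ T' → Par b (tlam e ⟨ T ⟩) (e' [ T' ]τ)
  pbeta : {e e' : Ev n (suc m)} {f f' : Ev n m} →
          Par βμτo e e' → Par βμτo f f' → Par βμτo (elam e ∙ f) (e' [ f' ]ε)
  punf  : {e e' : Ev n (suc m)} → Par βμτo e e' → Par βμτo (mu e) (e' [ mu e' ]ε)

par-refl : (e : Ev n m) → Par b e e
par-refl (evar a)  = pvar
par-refl (econ k)  = pcon
par-refl (elam e)  = pelam (par-refl e)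
par-refl (e ∙ f)   = papp (par-refl e) (par-refl f)
par-refl (mu e)    = pmu (par-refl e)
par-refl (e ⟨ T ⟩) = ptapp (par-refl e) (⇛-refl T)
par-refl (tlam e)  = ptlam (par-refl e)

par-subTE : {σ σ' : Fin n → Ty n'} → σ ⇛ˢ σ' →
            {e e' : Ev n m} → Par b e e' → Par b (subTE σ e) (subTE σ' e')
par-subTE h pvar        = pvar
par-subTE h pcon        = pcon
par-subTE h (pelam p)   = pelam (par-subTE h p)
par-subTE h (ptlam p)   = ptlam (par-subTE (⇛ˢ-extsT h) p)
par-subTE h (papp p q)  = papp (par-subTE h p) (par-subTE h q)
par-subTE h (pmu p)     = pmu (par-subTE h p)
par-subTE h (ptapp p t) = ptapp (par-subTE h p) (⇛-subT h t)
par-subTE {b = b} {σ' = σ'} h (ptau {e' = e'} {T' = T'} p t) =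
  subst (Par b _) (sym (subTE-[]τ σ' e' T')) (ptau (par-subTE (⇛ˢ-extsT h) p) (⇛-subT h t))
par-subTE {σ' = σ'} h (pbeta {e' = e'} {f' = f'} p q) =
  subst (Par βμτo _) (sym (subTE-[]ε σ' e' f')) (pbeta (par-subTE h p) (par-subTE h q))
par-subTE {σ' = σ'} h (punf {e' = e'} p) =
  subst (Par βμτo _) (sym (subTE-[]ε σ' e' (mu e'))) (punf (par-subTE h p))

-- Type renaming is the special case of substituting type variables.
par-renTE : (ρ : Fin n → Fin n') {e e' : Ev n m} → Par b e e' → Par b (renTE ρ e) (renTE ρ e')
par-renTE {b = b} ρ {e} {e'} p =
  subst₂ (Par b) (sym (renTE-as-subTE ρ e)) (sym (renTE-as-subTE ρ e')) (par-subTE (λ _ → tvar) p)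

par-[]τ : {e e' : Ev (suc n) m} {T T' : Ty n} → Par b e e' → T ⇛ T' → Par b (e [ T ]τ) (e' [ T' ]τ)
par-[]τ p t = par-subTE (⇛ˢ-single t) p

-- Stability under evidence renaming, needed to push Parˢ under binders.
par-renE : (ρ : Fin m → Fin m') {e e' : Ev n m} → Par b e e' → Par b (renE ρ e) (renE ρ e')
par-renE ρ pvar        = pvar
par-renE ρ pcon        = pcon
par-renE ρ (pelam p)   = pelam (par-renE (ext ρ) p)
par-renE ρ (ptlam p)   = ptlam (par-renE ρ p)
par-renE ρ (papp p q)  = papp (par-renE ρ p) (par-renE ρ q)
par-renE ρ (pmu p)     = pmu (par-renE (ext ρ) p)
par-renE ρ (ptapp p t) = ptapp (par-renE ρ p) t
par-renE {b = b} ρ (ptau {e' = e'} {T' = T'} p t) =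
  subst (Par b _) (sym (renE-[]τ ρ e' T')) (ptau (par-renE ρ p) t)
par-renE ρ (pbeta {e' = e'} {f' = f'} p q) =
  subst (Par βμτo _) (sym (renE-[]ε ρ e' f')) (pbeta (par-renE (ext ρ) p) (par-renE ρ q))
par-renE ρ (punf {e' = e'} p) =
  subst (Par βμτo _) (sym (renE-[]ε ρ e' (mu e'))) (punf (par-renE (ext ρ) p))

Parˢ : Mode → (σ σ' : Fin m → Ev n m') → Set
Parˢ b σ σ' = ∀ i → Par b (σ i) (σ' i)

parˢ-extsE : {σ σ' : Fin m → Ev n m'} → Parˢ b σ σ' → Parˢ b (extsE σ) (extsE σ')
parˢ-extsE h zero    = pvar
parˢ-extsE h (suc i) = par-renE suc (h i)

parˢ-weakenT : {σ σ' : Fin m → Ev n m'} → Parˢ b σ σ' →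
               Parˢ b (renTE suc ∘ σ) (renTE suc ∘ σ')
parˢ-weakenT h = par-renTE suc ∘ h

parˢ-single : {f f' : Ev n m} → Par b f f' → Parˢ b (single evar f) (single evar f')
parˢ-single q zero    = q
parˢ-single q (suc i) = pvar

par-subE : {σ σ' : Fin m → Ev n m'} → Parˢ b σ σ' →
           {e e' : Ev n m} → Par b e e' → Par b (subE σ e) (subE σ' e')
par-subE h (pvar {a = a}) = h a
par-subE h pcon           = pcon
par-subE h (pelam p)      = pelam (par-subE (parˢ-extsE h) p)
par-subE h (ptlam p)      = ptlam (par-subE (parˢ-weakenT h) p)
par-subE h (papp p q)     = papp (par-subE h p) (par-subE h q)
par-subE h (pmu p)        = pmu (par-subE (parˢ-extsE h) p)
par-subE h (ptapp p t)    = ptapp (par-subE h p) t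
par-subE {b = b} {σ' = σ'} h (ptau {e' = e'} {T' = T'} p t) =
  subst (Par b _) (sym (subE-[]τ σ' e' T')) (ptau (par-subE (parˢ-weakenT h) p) t)
par-subE {σ' = σ'} h (pbeta {e' = e'} {f' = f'} p q) =
  subst (Par βμτo _) (sym (subE-[]ε σ' e' f')) (pbeta (par-subE (parˢ-extsE h) p) (par-subE h q))
par-subE {σ' = σ'} h (punf {e' = e'} p) =
  subst (Par βμτo _) (sym (subE-[]ε σ' e' (mu e'))) (punf (par-subE (parˢ-extsE h) p))

par-[]ε : {e e' : Ev n (suc m)} {f f' : Ev n m} → Par b e e' → Par b f f' →
          Par b (e [ f ]ε) (e' [ f' ]ε)
par-[]ε p q = par-subE (parˢ-single q) p

-- Each redex is closed by contracting the residuals on both sides.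
par-diamond : Diamond (Par b {n} {m})
par-diamond pvar pvar = _ , pvar , pvar
par-diamond pcon pcon = _ , pcon , pcon
par-diamond (pelam p) (pelam q) with par-diamond p q
... | _ , p' , q' = _ , pelam p' , pelam q'
par-diamond (ptlam p) (ptlam q) with par-diamond p q
... | _ , p' , q' = _ , ptlam p' , ptlam q'
par-diamond (papp p₁ p₂) (papp q₁ q₂) with par-diamond p₁ q₁ | par-diamond p₂ q₂
... | _ , p₁' , q₁' | _ , p₂' , q₂' = _ , papp p₁' p₂' , papp q₁' q₂'
par-diamond (papp (pelam p₁) p₂) (pbeta q₁ q₂) with par-diamond p₁ q₁ | par-diamond p₂ q₂
... | _ , p₁' , q₁' | _ , p₂' , q₂' = _ , pbeta p₁' p₂' , par-[]ε q₁' q₂'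
par-diamond (pbeta p₁ p₂) (papp (pelam q₁) q₂) with par-diamond p₁ q₁ | par-diamond p₂ q₂
... | _ , p₁' , q₁' | _ , p₂' , q₂' = _ , par-[]ε p₁' p₂' , pbeta q₁' q₂'
par-diamond (pbeta p₁ p₂) (pbeta q₁ q₂) with par-diamond p₁ q₁ | par-diamond p₂ q₂
... | _ , p₁' , q₁' | _ , p₂' , q₂' = _ , par-[]ε p₁' p₂' , par-[]ε q₁' q₂'
par-diamond (pmu p) (pmu q) with par-diamond p q
... | _ , p' , q' = _ , pmu p' , pmu q'
par-diamond (pmu p) (punf q) with par-diamond p q
... | _ , p' , q' = _ , punf p' , par-[]ε q' (pmu q')
par-diamond (punf p) (pmu q) with par-diamond p q
... | _ , p' , q' = _ , par-[]ε p' (pmu p') , punf q'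
par-diamond (punf p) (punf q) with par-diamond p q
... | _ , p' , q' = _ , par-[]ε p' (pmu p') , par-[]ε q' (pmu q')
par-diamond (ptapp p t) (ptapp q u) with par-diamond p q | ⇛-diamond t u
... | _ , p' , q' | _ , t' , u' = _ , ptapp p' t' , ptapp q' u'
par-diamond (ptapp (ptlam p) t) (ptau q u) with par-diamond p q | ⇛-diamond t u
... | _ , p' , q' | _ , t' , u' = _ , ptau p' t' , par-[]τ q' u'
par-diamond (ptau p t) (ptapp (ptlam q) u) with par-diamond p q | ⇛-diamond t u
... | _ , p' , q' | _ , t' , u' = _ , par-[]τ p' t' , ptau q' u'
par-diamond (ptau p t) (ptau q u) with par-diamond p q | ⇛-diamond t u
... | _ , p' , q' | _ , t' , u' = _ , par-[]τ p' t' , par-[]τ q' u'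

Root : Mode → ERel
Root τo   = TauStep ⊎ʳ OStep
Root βμτo = BetaStep ⊎ʳ (MuStep ⊎ʳ (TauStep ⊎ʳ OStep))

Step : Mode → ERel
Step b = Ctx (Root b)

typeRoot : ∀ b {n m} {e e' : Ev n m} → (TauStep ⊎ʳ OStep) e e' → Root b e e'
typeRoot τo   = id
typeRoot βμτo = inj₂ ∘ inj₂

ctx-split : {R S : ERel} {e e' : Ev n m} → Ctx (R ⊎ʳ S) e e' → Ctx R e e' ⊎ Ctx S e e'
ctx-split (hole r)  = Sum.map hole hole r
ctx-split (appˡ c)  = Sum.map appˡ appˡ (ctx-split c)
ctx-split (tapp c)  = Sum.map tapp tapp (ctx-split c)
ctx-split (elam c)  = Sum.map elam elam (ctx-split c)
ctx-split (tlam c)  = Sum.map tlam tlam (ctx-split c)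
ctx-split (appʳ c)  = Sum.map appʳ appʳ (ctx-split c)
ctx-split (mu c)    = Sum.map mu mu (ctx-split c)

steps-app : ∀ b {n m} {e e' f f' : Ev n m} → Star (Step b) e e' → Star (Step b) f f' →
            Star (Step b) (e ∙ f) (e' ∙ f')
steps-app b {e' = e'} {f = f} es fs = gmap (_∙ f) appˡ es ◅◅ gmap (e' ∙_) appʳ fs

steps-tapp : ∀ b {n m} {e e' : Ev n m} {T T' : Ty n} → Star (Step b) e e' → T ⇛ T' →
             Star (Step b) (e ⟨ T ⟩) (e' ⟨ T' ⟩)
steps-tapp b {e' = e'} {T = T} es t =
  gmap (_⟨ T ⟩) tapp es ◅◅ gmap (e' ⟨_⟩) (hole ∘ typeRoot b ∘ inj₂ ∘ ostep) (⇛⇒→o* t)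

-- A parallel step is performed sequentially: first reduce the subterms,
-- then contract the root redex.
par⇒steps : {e e' : Ev n m} → Par b e e' → Star (Step b) e e'
par⇒steps pvar      = ε
par⇒steps pcon      = ε
par⇒steps (pelam p) = gmap Ev.elam Ctx.elam (par⇒steps p)
par⇒steps (ptlam p) = gmap Ev.tlam Ctx.tlam (par⇒steps p)
par⇒steps (pmu p)   = gmap Ev.mu Ctx.mu (par⇒steps p)
par⇒steps {b = b} (papp p q)  = steps-app b (par⇒steps p) (par⇒steps q)
par⇒steps {b = b} (ptapp p t) = steps-tapp b (par⇒steps p) t
par⇒steps {b = b} (ptau p t)  =
  steps-tapp b (gmap Ev.tlam Ctx.tlam (par⇒steps p)) t ◅◅ hole (typeRoot b (inj₁ tau)) ◅ ε
par⇒steps (pbeta p q) =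
  steps-app βμτo (gmap Ev.elam Ctx.elam (par⇒steps p)) (par⇒steps q) ◅◅ hole (inj₁ beta) ◅ ε
par⇒steps (punf p) =
  gmap Ev.mu Ctx.mu (par⇒steps p) ◅◅ hole (inj₂ (inj₁ unfold)) ◅ ε

-- A single step is a parallel step that leaves everything off its redex
-- unchanged; this reduces to the root steps.
ctx⇒par : {R : ERel} → (∀ {n m} {e e' : Ev n m} → R e e' → Par b e e') →
          {e e' : Ev n m} → Ctx R e e' → Par b e e'
ctx⇒par root (hole r) = root r
ctx⇒par root (appˡ c) = papp (ctx⇒par root c) (par-refl _)
ctx⇒par root (tapp c) = ptapp (ctx⇒par root c) (⇛-refl _)
ctx⇒par root (elam c) = pelam (ctx⇒par root c)
ctx⇒par root (tlam c) = ptlam (ctx⇒par root c)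
ctx⇒par root (appʳ c) = papp (par-refl _) (ctx⇒par root c)
ctx⇒par root (mu c)   = pmu (ctx⇒par root c)

τ⇒par : {e e' : Ev n m} → TauStep e e' → Par b e e'
τ⇒par tau = ptau (par-refl _) (⇛-refl _)

o⇒par : {e e' : Ev n m} → OStep e e' → Par b e e'
o⇒par (ostep s) = ptapp (par-refl _) (→o⇒⇛ s)

β⇒par : {e e' : Ev n m} → BetaStep e e' → Par βμτo e e'
β⇒par beta = pbeta (par-refl _) (par-refl _)

μ⇒par : {e e' : Ev n m} → MuStep e e' → Par βμτo e e'
μ⇒par unfold = punf (par-refl _)

βμτo⇒par : {e e' : Ev n m} → e ↝βμτo e' → Par βμτo e e'
βμτo⇒par = Sum.[ ctx⇒par β⇒par , Sum.[ ctx⇒par μ⇒par , Sum.[ ctx⇒par τ⇒par , ctx⇒par o⇒par ] ] ]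

step⇒βμτo : {e e' : Ev n m} → Step βμτo e e' → e ↝βμτo e'
step⇒βμτo = Sum.map₂ (Sum.map₂ ctx-split ∘ ctx-split) ∘ ctx-split

βμτo-confluent : Confluent (_↝βμτo_ {n} {m})
βμτo-confluent = confluent-between βμτo⇒par (Star-map step⇒βμτo ∘ par⇒steps)
                                   (diamond⇒confluent par-diamond)

data Hp : ∀ {n m} → Ev n m → Ev n m → Set where
  hvar  : {a : Fin m} → Hp {n} (evar a) (evar a)
  hcon  : ∀ {k} → Hp {n} {m} (econ k) (econ k)
  helam : {e e' : Ev n (suc m)} → Hp e e' → Hp (elam e) (elam e')
  htlam : {e e' : Ev (suc n) m} → Hp e e' → Hp (tlam e) (tlam e')
  happ  : {e e' f f' : Ev n m} → Hp e e' → Par τo f f' → Hp (e ∙ f) (e' ∙ f')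
  hmu   : {e e' : Ev n (suc m)} → Par τo e e' → Hp (mu e) (mu e')
  htapp : {e e' : Ev n m} {T T' : Ty n} → Par τo e e' → T ⇛ T' → Hp (e ⟨ T ⟩) (e' ⟨ T' ⟩)
  htau  : {e e' : Ev (suc n) m} {T T' : Ty n} →
          Par τo e e' → T ⇛ T' → Hp (tlam e ⟨ T ⟩) (e' [ T' ]τ)
  hbeta : {e e' : Ev n (suc m)} {f f' : Ev n m} →
          Hp e e' → Par τo f f' → Hp (elam e ∙ f) (e' [ f' ]ε)
  hunf  : {e e' : Ev n (suc m)} → Par τo e e' → Hp (mu e) (e' [ mu e' ]ε)

par⇒hp : {e e' : Ev n m} → Par τo e e' → Hp e e'
par⇒hp pvar        = hvar
par⇒hp pcon        = hcon
par⇒hp (pelam p)   = helam (par⇒hp p)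
par⇒hp (ptlam p)   = htlam (par⇒hp p)
par⇒hp (papp p q)  = happ (par⇒hp p) q
par⇒hp (pmu p)     = hmu p
par⇒hp (ptapp p t) = htapp p t
par⇒hp (ptau p t)  = htau p t

hp-subE : {σ σ' : Fin m → Ev n m'} → Parˢ τo σ σ' →
          {e e' : Ev n m} → Hp e e' → Hp (subE σ e) (subE σ' e')
hp-subE h (hvar {a = a}) = par⇒hp (h a)
hp-subE h hcon           = hcon
hp-subE h (helam p)      = helam (hp-subE (parˢ-extsE h) p)
hp-subE h (htlam p)      = htlam (hp-subE (parˢ-weakenT h) p)
hp-subE h (happ p q)     = happ (hp-subE h p) (par-subE h q)
hp-subE h (hmu p)        = hmu (par-subE (parˢ-extsE h) p)
hp-subE h (htapp p t)    = htapp (par-subE h p) t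
hp-subE {σ' = σ'} h (htau {e' = e'} {T' = T'} p t) =
  subst (Hp _) (sym (subE-[]τ σ' e' T')) (htau (par-subE (parˢ-weakenT h) p) t)
hp-subE {σ' = σ'} h (hbeta {e' = e'} {f' = f'} p q) =
  subst (Hp _) (sym (subE-[]ε σ' e' f')) (hbeta (hp-subE (parˢ-extsE h) p) (par-subE h q))
hp-subE {σ' = σ'} h (hunf {e' = e'} p) =
  subst (Hp _) (sym (subE-[]ε σ' e' (mu e'))) (hunf (par-subE (parˢ-extsE h) p))

hp-[]ε : {e e' : Ev n (suc m)} {f f' : Ev n m} → Hp e e' → Par τo f f' →
         Hp (e [ f ]ε) (e' [ f' ]ε)
hp-[]ε p q = hp-subE (parˢ-single q) p

-- Off-spine subterms are joined by the diamond property of Par τo.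
hp-diamond : Diamond (Hp {n} {m})
hp-diamond hvar hvar = _ , hvar , hvar
hp-diamond hcon hcon = _ , hcon , hcon
hp-diamond (helam p) (helam q) with hp-diamond p q
... | _ , p' , q' = _ , helam p' , helam q'
hp-diamond (htlam p) (htlam q) with hp-diamond p q
... | _ , p' , q' = _ , htlam p' , htlam q'
hp-diamond (happ p₁ p₂) (happ q₁ q₂) with hp-diamond p₁ q₁ | par-diamond p₂ q₂
... | _ , p₁' , q₁' | _ , p₂' , q₂' = _ , happ p₁' p₂' , happ q₁' q₂'
hp-diamond (happ (helam p₁) p₂) (hbeta q₁ q₂) with hp-diamond p₁ q₁ | par-diamond p₂ q₂
... | _ , p₁' , q₁' | _ , p₂' , q₂' = _ , hbeta p₁' p₂' , hp-[]ε q₁' q₂'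
hp-diamond (hbeta p₁ p₂) (happ (helam q₁) q₂) with hp-diamond p₁ q₁ | par-diamond p₂ q₂
... | _ , p₁' , q₁' | _ , p₂' , q₂' = _ , hp-[]ε p₁' p₂' , hbeta q₁' q₂'
hp-diamond (hbeta p₁ p₂) (hbeta q₁ q₂) with hp-diamond p₁ q₁ | par-diamond p₂ q₂
... | _ , p₁' , q₁' | _ , p₂' , q₂' = _ , hp-[]ε p₁' p₂' , hp-[]ε q₁' q₂'
hp-diamond (hmu p) (hmu q) with par-diamond p q
... | _ , p' , q' = _ , hmu p' , hmu q'
hp-diamond (hmu p) (hunf q) with par-diamond p q
... | _ , p' , q' = _ , hunf p' , hp-[]ε (par⇒hp q') (pmu q')
hp-diamond (hunf p) (hmu q) with par-diamond p q
... | _ , p' , q' = _ , hp-[]ε (par⇒hp p') (pmu p') , hunf q'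
hp-diamond (hunf p) (hunf q) with par-diamond p q
... | _ , p' , q' = _ , hp-[]ε (par⇒hp p') (pmu p') , hp-[]ε (par⇒hp q') (pmu q')
hp-diamond (htapp p t) (htapp q u) with par-diamond p q | ⇛-diamond t u
... | _ , p' , q' | _ , t' , u' = _ , htapp p' t' , htapp q' u'
hp-diamond (htapp (ptlam p) t) (htau q u) with par-diamond p q | ⇛-diamond t u
... | _ , p' , q' | _ , t' , u' = _ , htau p' t' , par⇒hp (par-[]τ q' u')
hp-diamond (htau p t) (htapp (ptlam q) u) with par-diamond p q | ⇛-diamond t u
... | _ , p' , q' | _ , t' , u' = _ , par⇒hp (par-[]τ p' t') , htau q' u'
hp-diamond (htau p t) (htau q u) with par-diamond p q | ⇛-diamond t u
... | _ , p' , q' | _ , t' , u' = _ , par⇒hp (par-[]τ p' t') , par⇒hp (par-[]τ q' u')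

hτo-elam : {e e' : Ev n (suc m)} → e ↝hτo e' → elam e ↝hτo elam e'
hτo-elam = Sum.map HCtx.elam (Sum.map Ctx.elam Ctx.elam)

hτo-tlam : {e e' : Ev (suc n) m} → e ↝hτo e' → tlam e ↝hτo tlam e'
hτo-tlam = Sum.map HCtx.tlam (Sum.map Ctx.tlam Ctx.tlam)

hτo-appˡ : {e e' f : Ev n m} → e ↝hτo e' → (e ∙ f) ↝hτo (e' ∙ f)
hτo-appˡ = Sum.map HCtx.appˡ (Sum.map Ctx.appˡ Ctx.appˡ)

-- Par τo performs only τ- and o-steps, which are ↝hτo-steps.
par⇒hτo* : {e e' : Ev n m} → Par τo e e' → Star _↝hτo_ e e'
par⇒hτo* = Star-map (inj₂ ∘ ctx-split) ∘ par⇒steps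

hp⇒hτo* : {e e' : Ev n m} → Hp e e' → Star _↝hτo_ e e'
hp⇒hτo* hvar        = ε
hp⇒hτo* hcon        = ε
hp⇒hτo* (helam p)   = gmap Ev.elam hτo-elam (hp⇒hτo* p)
hp⇒hτo* (htlam p)   = gmap Ev.tlam hτo-tlam (hp⇒hτo* p)
hp⇒hτo* (happ {e' = e'} {f = f} p q) =
  gmap (_∙ f) hτo-appˡ (hp⇒hτo* p) ◅◅ par⇒hτo* (papp (par-refl e') q)
hp⇒hτo* (hmu p)     = par⇒hτo* (pmu p)
hp⇒hτo* (htapp p t) = par⇒hτo* (ptapp p t)
hp⇒hτo* (htau p t)  = par⇒hτo* (ptau p t)
hp⇒hτo* (hbeta {e' = e'} {f = f} p q) =
  gmap (_∙ f) hτo-appˡ (gmap Ev.elam hτo-elam (hp⇒hτo* p))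
  ◅◅ par⇒hτo* (papp (par-refl (elam e')) q) ◅◅ inj₁ (hole (inj₂ beta)) ◅ ε
hp⇒hτo* (hunf p)    = par⇒hτo* (pmu p) ◅◅ inj₁ (hole (inj₁ unfold)) ◅ ε

h⇒hp : {e e' : Ev n m} → e ↝h e' → Hp e e'
h⇒hp (hole (inj₁ unfold)) = hunf (par-refl _)
h⇒hp (hole (inj₂ beta))   = hbeta (par⇒hp (par-refl _)) (par-refl _)
h⇒hp (appˡ c)             = happ (h⇒hp c) (par-refl _)
h⇒hp (elam c)             = helam (h⇒hp c)
h⇒hp (tlam c)             = htlam (h⇒hp c)

hτo⇒hp : {e e' : Ev n m} → e ↝hτo e' → Hp e e'
hτo⇒hp = Sum.[ h⇒hp , par⇒hp ∘ Sum.[ ctx⇒par τ⇒par , ctx⇒par o⇒par ] ]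

hτo-confluent : Confluent (_↝hτo_ {n} {m})
hτo-confluent = confluent-between hτo⇒hp hp⇒hτo* (diamond⇒confluent hp-diamond)

typeApps : Ev n m → ℕ
typeApps (evar a)  = 0
typeApps (econ k)  = 0
typeApps (elam e)  = typeApps e
typeApps (e ∙ f)   = typeApps e + typeApps f
typeApps (mu e)    = typeApps e
typeApps (e ⟨ T ⟩) = suc (typeApps e)
typeApps (tlam e)  = typeApps e

-- Type substitution only changes the types, never the evidence structure.
typeApps-subTE : (σ : Fin n → Ty n') (e : Ev n m) → typeApps (subTE σ e) ≡ typeApps e
typeApps-subTE σ (evar x)  = refl
typeApps-subTE σ (econ k)  = refl
typeApps-subTE σ (elam e)  = typeApps-subTE σ e
typeApps-subTE σ (e ∙ f)   = cong₂ _+_ (typeApps-subTE σ e) (typeApps-subTE σ f)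
typeApps-subTE σ (mu e)    = typeApps-subTE σ e
typeApps-subTE σ (e ⟨ T ⟩) = cong suc (typeApps-subTE σ e)
typeApps-subTE σ (tlam e)  = typeApps-subTE (extsT σ) e

τ-decreases : {e e' : Ev n m} → e ↝τ e' → typeApps e' < typeApps e
τ-decreases (hole (tau {e = e} {T = T})) = s≤s (≤-reflexive (typeApps-subTE (single var T) e))
τ-decreases (appˡ {f = f} c) = +-monoˡ-< (typeApps f) (τ-decreases c)
τ-decreases (tapp c)         = s≤s (τ-decreases c)
τ-decreases (elam c)         = τ-decreases c
τ-decreases (tlam c)         = τ-decreases c
τ-decreases (appʳ {f = f} c) = +-monoʳ-< (typeApps f) (τ-decreases c)
τ-decreases (mu c)           = τ-decreases c

τ-sn : StronglyNormalizing (_↝τ_ {n} {m})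
τ-sn = sn-by-measure typeApps τ-decreases

theorem11 : (∀ {n m : ℕ} → Confluent (_↝βμτo_ {n} {m}))
          × (∀ {n m : ℕ} → Confluent (_↝hτo_ {n} {m}))
          × (∀ {n m : ℕ} → StronglyNormalizing (_↝τ_ {n} {m}))
theorem11 = βμτo-confluent , hτo-confluent , τ-sn
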